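{- Let $G$ be an undirected graph, let $C_1$ and $C_2$ be closed walks of odd length in $G$, and let $e_1=v_1u_1$ and $e_2=u_2v_2$ be stubborn edges of $G$. Suppose that for $j=1,2$, $W_j$ is a walk from $u_1$ to $u_2$ formed by consecutive edges of $C_j$ (a segment of $C_j$, read cyclically) which uses neither $e_1$ nor $e_2$. Let $c:E(G)\to\{1,2\}$ be an arbitrary 2-edge-colouring, and for $j=1,2$ let $n_j$ be the number of pairs of consecutive edges of the same colour in the walk $e_1W_je_2$ (the walk traversing $e_1$ from $v_1$ to $u_1$, then $W_j$, then $e_2$ from $u_2$ to $v_2$). Then $n_1$ and $n_2$ have the same parity.
   Context: A walk is a sequence of vertices with consecutive vertices adjacent (vertices and edges may repeat); its length is its number of edges; it is closed if it starts and ends at the same vertex. An edge is stubborn if it belongs to every closed walk of odd length in $G$. For a walk with edge sequence $f_1,\dots,f_m$, the number of pairs of consecutive edges of the same colour is the number of indices $i\in\{1,\dots,m-1\}$ with $c(f_i)=c(f_{i+1})$. -}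

module Defs where

open import Data.Nat using (ℕ; zero; suc; _%_; _+_)
open import Data.Bool using (Bool; true; false; if_then_else_)
open import Data.Fin using (Fin)
open import Data.Fin.Properties using () renaming (_≟_ to _≟ᶠ_)
open import Data.List using (List; []; _∷_; _++_; length)
open import Data.List.Relation.Unary.Any using (Any)
open import Data.Product using (Σ; ∃; ∃-syntax; _×_; _,_)
open import Data.Sum using (_⊎_)
open import Data.Empty using (⊥)
open import Relation.Nullary using (¬_; yes; no; does)
open import Relation.Binary.PropositionalEquality using (_≡_)

record Graph : Set₁ where
  field
    V       : Set
    Adj     : V → V → Set
    sym     : ∀ {x y} → Adj x y → Adj y x
    irrefl  : ∀ {x} → ¬ Adj x x

module _ (G : Graph) where
  open Graph G

  data Chain : V → List V → Set where
    []  : ∀ {x} → Chain x []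
    _∷_ : ∀ {x y ys} → Adj x y → Chain y ys → Chain x (y ∷ ys)

  -- a walk v₀ v₁ … v_m is given by v₀ (start) and the list v₁ … v_m (rest)
  record Walk : Set where
    constructor walk
    field
      start : V
      rest  : List V
      chain : Chain start rest

module _ {V : Set} where
  lastV : V → List V → V
  lastV x []       = x
  lastV x (y ∷ ys) = lastV y ys

  edgesFrom : V → List V → List (V × V)
  edgesFrom x []       = []
  edgesFrom x (y ∷ ys) = (x , y) ∷ edgesFrom y ys

  SameEdge : V × V → V × V → Set
  SameEdge (a , b) (x , y) = (a ≡ x × b ≡ y) ⊎ (a ≡ y × b ≡ x)

Odd : ℕ → Set
Odd n = n % 2 ≡ 1

module _ {G : Graph} where
  open Graph G
  open Walk

  len : Walk G → ℕ
  len w = length (rest w)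

  endV : Walk G → V
  endV w = lastV (start w) (rest w)

  edges : Walk G → List (V × V)
  edges w = edgesFrom (start w) (rest w)

  Closed : Walk G → Set
  Closed w = endV w ≡ start w

  UsesEdge : Walk G → V × V → Set
  UsesEdge w e = Any (SameEdge e) (edges w)

  Stubborn : V × V → Set
  Stubborn (x , y) = Adj x y × (∀ (C : Walk G) → Closed C → Odd (len C) → UsesEdge C (x , y))

  WalkFromTo : Walk G → V → V → Set
  WalkFromTo w a b = start w ≡ a × endV w ≡ b

  -- W is formed by consecutive edges of the closed walk C, read cyclically:
  -- the edge sequence of W is a contiguous block of a cyclic rotation of the
  -- edge sequence of C.
  SegmentOf : Walk G → Walk G → Set
  SegmentOf W C = ∃[ xs ] ∃[ ys ] ∃[ p ] ∃[ s ]
    (edges C ≡ xs ++ ys × ys ++ xs ≡ p ++ edges W ++ s)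

  -- 2-edge-colouring: a colour for each (unordered) edge, encoded as a
  -- function on ordered pairs that is symmetric on adjacent pairs
  -- (values on non-adjacent pairs are irrelevant).
  record Colouring : Set where
    field
      col    : V → V → Fin 2
      colSym : ∀ {x y} → Adj x y → col x y ≡ col y x
  open Colouring public

  sameCount : List (Fin 2) → ℕ
  sameCount []           = 0
  sameCount (a ∷ [])     = 0
  sameCount (a ∷ b ∷ cs) =
    (if does (a ≟ᶠ b) then 1 else 0) + sameCount (b ∷ cs)

  colours : Colouring → List (V × V) → List (Fin 2)
  colours c []             = []
  colours c ((x , y) ∷ es) = col c x y ∷ colours c es

  sameInExtended : Colouring → V → Walk G → V → ℕ
  sameInExtended c v₁ W v₂ =
    sameCount (colours c (edgesFrom v₁ (start W ∷ rest W ++ v₂ ∷ [])))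

-- In a colour sequence a₀ … aₘ each of the m consecutive pairs is either equal or a change, and with
-- only two colours the number of changes is ≡ [a₀ ≠ aₘ] mod 2. Hence the count for e₁ Wⱼ e₂ is
-- ≡ len Wⱼ + 1 + [c(e₁) ≠ c(e₂)] mod 2. Finally len W₁ ≡ len W₂ mod 2, since otherwise W₁ followed by
-- W₂ reversed is a closed walk of odd length avoiding the stubborn edge e₁.
module Submission where

open import Defs
open import Data.Nat using (_%_)
open import Data.Product using (_×_; _,_)
open import Relation.Nullary using (¬_)
open import Relation.Binary.PropositionalEquality using (_≡_)

open import Data.Nat.Base using (zero; suc; _+_; parity)
open import Data.Nat.Properties using (+-identityʳ; +-suc; +-comm)
open import Data.Parity.Base using (Parity; 0ℙ; 1ℙ; _⁻¹) renaming (_+_ to _+ℙ_)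
open import Data.Parity.Properties using (⁻¹-involutive; ⁻¹-selfInverse; suc-homo-⁻¹; +-homo-+)
open import Data.Bool.Base using (true; false; if_then_else_)
open import Data.Fin.Base using (Fin; zero; suc)
open import Data.Fin.Properties using () renaming (_≟_ to _≟ᶠ_)
open import Data.List.Base using (List; []; _∷_; _++_; length)
open import Data.List.Properties using (length-++)
open import Data.List.Relation.Unary.Any using (Any; here; there)
open import Data.List.Relation.Unary.Any.Properties using (++⁻)
open import Data.Sum.Base using (_⊎_; inj₁; inj₂; [_,_])
open import Data.Empty using (⊥-elim)
open import Function.Base using (id)
open import Relation.Nullary using (does)
open import Relation.Binary.PropositionalEquality using (refl; sym; trans; cong; cong₂; subst; module ≡-Reasoning)

open ≡-Reasoning

parity⇒%2 : ∀ m n → parity m ≡ parity n → m % 2 ≡ n % 2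
parity⇒%2 zero          zero                _  = refl
parity⇒%2 zero          (suc zero)          ()
parity⇒%2 zero          (suc (suc n))       eq = parity⇒%2 zero n eq
parity⇒%2 (suc zero)    zero                ()
parity⇒%2 (suc zero)    (suc zero)          _  = refl
parity⇒%2 (suc zero)    (suc (suc n))       eq = parity⇒%2 1 n eq
parity⇒%2 (suc (suc m)) n                   eq = parity⇒%2 m n eq

parity-suc : ∀ n → parity (suc n) ≡ parity n ⁻¹
parity-suc n = sym (⁻¹-selfInverse (suc-homo-⁻¹ n))

+ℙ≢1ℙ⇒≡ : ∀ {p q} → ¬ p +ℙ q ≡ 1ℙ → p ≡ q
+ℙ≢1ℙ⇒≡ {0ℙ} {0ℙ} _ = refl
+ℙ≢1ℙ⇒≡ {0ℙ} {1ℙ} h = ⊥-elim (h refl)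
+ℙ≢1ℙ⇒≡ {1ℙ} {0ℙ} h = ⊥-elim (h refl)
+ℙ≢1ℙ⇒≡ {1ℙ} {1ℙ} _ = refl

⁻¹-exchange : ∀ p q r → p ⁻¹ +ℙ (q +ℙ r) ≡ q ⁻¹ +ℙ (p +ℙ r)
⁻¹-exchange 0ℙ 0ℙ r = refl
⁻¹-exchange 0ℙ 1ℙ r = ⁻¹-involutive r
⁻¹-exchange 1ℙ 0ℙ r = sym (⁻¹-involutive r)
⁻¹-exchange 1ℙ 1ℙ r = refl

change : Fin 2 → Fin 2 → Parity
change a b = if does (a ≟ᶠ b) then 0ℙ else 1ℙ

change-refl : ∀ a → change a a ≡ 0ℙ
change-refl zero       = refl
change-refl (suc zero) = refl

-- Holds only because there are just two colours.
change-trans : ∀ a b c → change a c ≡ change a b +ℙ change b c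
change-trans zero       zero       zero       = refl
change-trans zero       zero       (suc zero) = refl
change-trans zero       (suc zero) zero       = refl
change-trans zero       (suc zero) (suc zero) = refl
change-trans (suc zero) zero       zero       = refl
change-trans (suc zero) zero       (suc zero) = refl
change-trans (suc zero) (suc zero) zero       = refl
change-trans (suc zero) (suc zero) (suc zero) = refl

parity-indicator : ∀ d → parity (if d then 1 else 0) ≡ (if d then 0ℙ else 1ℙ) ⁻¹
parity-indicator true  = refl
parity-indicator false = refl

module _ {V : Set} where

  lastV-++ : ∀ (x : V) ys zs → lastV x (ys ++ zs) ≡ lastV (lastV x ys) zs
  lastV-++ x []       zs = refl
  lastV-++ x (y ∷ ys) zs = lastV-++ y ys zs

  edgesFrom-++ : ∀ (x : V) ys zs →
    edgesFrom x (ys ++ zs) ≡ edgesFrom x ys ++ edgesFrom (lastV x ys) zs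
  edgesFrom-++ x []       zs = refl
  edgesFrom-++ x (y ∷ ys) zs = cong ((x , y) ∷_) (edgesFrom-++ y ys zs)

  -- The vertices after lastV x ys on the walk that runs back along x ∷ ys and then continues along acc.
  reverseOnto : V → List V → List V → List V
  reverseOnto x []       acc = acc
  reverseOnto x (y ∷ ys) acc = reverseOnto y ys (x ∷ acc)

  length-reverseOnto : ∀ (x : V) ys acc → length (reverseOnto x ys acc) ≡ length ys + length acc
  length-reverseOnto x []       acc = refl
  length-reverseOnto x (y ∷ ys) acc = trans (length-reverseOnto y ys (x ∷ acc)) (+-suc (length ys) (length acc))

  lastV-reverseOnto : ∀ (x : V) ys acc → lastV (lastV x ys) (reverseOnto x ys acc) ≡ lastV x acc
  lastV-reverseOnto x []       acc = refl
  lastV-reverseOnto x (y ∷ ys) acc = lastV-reverseOnto y ys (x ∷ acc)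

  SameEdge-swap : ∀ {e : V × V} {x y} → SameEdge e (y , x) → SameEdge e (x , y)
  SameEdge-swap (inj₁ p) = inj₂ p
  SameEdge-swap (inj₂ p) = inj₁ p

  Any-edgesFrom-reverseOnto⁻ : ∀ {e : V × V} x ys acc →
    Any (SameEdge e) (edgesFrom (lastV x ys) (reverseOnto x ys acc)) →
    Any (SameEdge e) (edgesFrom x ys) ⊎ Any (SameEdge e) (edgesFrom x acc)
  Any-edgesFrom-reverseOnto⁻ x []       acc p = inj₂ p
  Any-edgesFrom-reverseOnto⁻ x (y ∷ ys) acc p with Any-edgesFrom-reverseOnto⁻ y ys (x ∷ acc) p
  ... | inj₁ q         = inj₁ (there q)
  ... | inj₂ (here q)  = inj₁ (here (SameEdge-swap q))
  ... | inj₂ (there q) = inj₂ q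

module _ {G : Graph} where
  open Graph G renaming (sym to Adj-sym)
  open Walk

  Chain-++ : ∀ {x} ys {zs} → Chain G x ys → Chain G (lastV x ys) zs → Chain G x (ys ++ zs)
  Chain-++ []       []       c = c
  Chain-++ (y ∷ ys) (a ∷ ch) c = a ∷ Chain-++ ys ch c

  Chain-reverseOnto : ∀ x ys {acc} → Chain G x ys → Chain G x acc →
    Chain G (lastV x ys) (reverseOnto x ys acc)
  Chain-reverseOnto x []       []       c = c
  Chain-reverseOnto x (y ∷ ys) (a ∷ ch) c = Chain-reverseOnto y ys ch (Adj-sym a ∷ c)

  reverseWalk : Walk G → Walk G
  reverseWalk (walk x ys ch) = walk (lastV x ys) (reverseOnto x ys []) (Chain-reverseOnto x ys ch [])

  appendWalk : (w w′ : Walk G) → endV w ≡ start w′ → Walk G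
  appendWalk (walk x ys ch) (walk .(lastV x ys) zs ch′) refl = walk x (ys ++ zs) (Chain-++ ys ch ch′)

  len-reverseWalk : ∀ w → len (reverseWalk w) ≡ len w
  len-reverseWalk (walk x ys _) = trans (length-reverseOnto x ys []) (+-identityʳ (length ys))

  endV-reverseWalk : ∀ w → endV (reverseWalk w) ≡ start w
  endV-reverseWalk (walk x ys _) = lastV-reverseOnto x ys []

  UsesEdge-reverseWalk⁻ : ∀ w {e} → UsesEdge (reverseWalk w) e → UsesEdge w e
  UsesEdge-reverseWalk⁻ (walk x ys _) p = [ id , (λ ()) ] (Any-edgesFrom-reverseOnto⁻ x ys [] p)

  len-appendWalk : ∀ w w′ eq → len (appendWalk w w′ eq) ≡ len w + len w′
  len-appendWalk (walk x ys _) (walk _ zs _) refl = length-++ ys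

  start-appendWalk : ∀ w w′ eq → start (appendWalk w w′ eq) ≡ start w
  start-appendWalk (walk x ys _) (walk _ zs _) refl = refl

  endV-appendWalk : ∀ w w′ eq → endV (appendWalk w w′ eq) ≡ endV w′
  endV-appendWalk (walk x ys _) (walk _ zs _) refl = lastV-++ x ys zs

  UsesEdge-appendWalk⁻ : ∀ w w′ eq {e} → UsesEdge (appendWalk w w′ eq) e → UsesEdge w e ⊎ UsesEdge w′ e
  UsesEdge-appendWalk⁻ (walk x ys _) (walk _ zs _) refl p =
    ++⁻ (edgesFrom x ys) (subst (Any (SameEdge _)) (edgesFrom-++ x ys zs) p)

  stubborn-len-parity : ∀ {e a b} (W₁ W₂ : Walk G) → Stubborn {G} e →
    WalkFromTo W₁ a b → WalkFromTo W₂ a b → ¬ UsesEdge W₁ e → ¬ UsesEdge W₂ e →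
    parity (len W₁) ≡ parity (len W₂)
  stubborn-len-parity W₁ W₂ (_ , onOddClosed) (s₁ , t₁) (s₂ , t₂) avoid₁ avoid₂ = +ℙ≢1ℙ⇒≡ λ odd →
    [ avoid₁ , (λ u → avoid₂ (UsesEdge-reverseWalk⁻ W₂ u)) ]
      (UsesEdge-appendWalk⁻ W₁ W₂ᵒ meet (onOddClosed C closed (parity⇒%2 (len C) 1 (parity-len-C odd))))
    where
    W₂ᵒ : Walk G
    W₂ᵒ = reverseWalk W₂
    meet : endV W₁ ≡ start W₂ᵒ
    meet = trans t₁ (sym t₂)
    C : Walk G
    C = appendWalk W₁ W₂ᵒ meet
    closed : Closed {G} C
    closed = begin
      endV C   ≡⟨ endV-appendWalk W₁ W₂ᵒ meet ⟩
      endV W₂ᵒ ≡⟨ endV-reverseWalk W₂ ⟩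
      start W₂ ≡⟨ trans s₂ (sym s₁) ⟩
      start W₁ ≡⟨ sym (start-appendWalk W₁ W₂ᵒ meet) ⟩
      start C  ∎
    parity-len-C : parity (len W₁) +ℙ parity (len W₂) ≡ 1ℙ → parity (len C) ≡ 1ℙ
    parity-len-C odd = begin
      parity (len C)                     ≡⟨ cong parity (len-appendWalk W₁ W₂ᵒ meet) ⟩
      parity (len W₁ + len W₂ᵒ)          ≡⟨ +-homo-+ (len W₁) (len W₂ᵒ) ⟩
      parity (len W₁) +ℙ parity (len W₂ᵒ) ≡⟨ cong (λ n → parity (len W₁) +ℙ parity n) (len-reverseWalk W₂) ⟩
      parity (len W₁) +ℙ parity (len W₂)  ≡⟨ odd ⟩
      1ℙ                                 ∎

  parity-sameCount : ∀ a cs →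
    parity (sameCount {G} (a ∷ cs)) ≡ parity (length cs) +ℙ change a (lastV a cs)
  parity-sameCount a []       = sym (change-refl a)
  parity-sameCount a (b ∷ cs) = begin
    parity (same + sameCount {G} (b ∷ cs))
      ≡⟨ +-homo-+ same (sameCount {G} (b ∷ cs)) ⟩
    parity same +ℙ parity (sameCount {G} (b ∷ cs))
      ≡⟨ cong₂ _+ℙ_ (parity-indicator (does (a ≟ᶠ b))) (parity-sameCount b cs) ⟩
    change a b ⁻¹ +ℙ (parity (length cs) +ℙ change b (lastV b cs))
      ≡⟨ ⁻¹-exchange (change a b) (parity (length cs)) _ ⟩
    parity (length cs) ⁻¹ +ℙ (change a b +ℙ change b (lastV b cs))
      ≡⟨ cong₂ _+ℙ_ (sym (parity-suc (length cs))) (sym (change-trans a b _)) ⟩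
    parity (suc (length cs)) +ℙ change a (lastV b cs) ∎
    where same = if does (a ≟ᶠ b) then 1 else 0

  length-colours-edgesFrom : ∀ (c : Colouring {G}) x ys → length (colours c (edgesFrom x ys)) ≡ length ys
  length-colours-edgesFrom c x []       = refl
  length-colours-edgesFrom c x (y ∷ ys) = cong suc (length-colours-edgesFrom c y ys)

  lastV-colours-edgesFrom : ∀ (c : Colouring {G}) a x ys y →
    lastV a (colours c (edgesFrom x (ys ++ y ∷ []))) ≡ col c (lastV x ys) y
  lastV-colours-edgesFrom c a x []       y = refl
  lastV-colours-edgesFrom c a x (z ∷ zs) y = lastV-colours-edgesFrom c (col c x z) z zs y

  parity-sameInExtended : ∀ (c : Colouring {G}) v₁ W v₂ →
    parity (sameInExtended c v₁ W v₂) ≡ parity (len W) ⁻¹ +ℙ change (col c v₁ (start W)) (col c (endV W) v₂)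
  parity-sameInExtended c v₁ (walk s r _) v₂ = begin
    parity (sameCount {G} (a ∷ cs))
      ≡⟨ parity-sameCount a cs ⟩
    parity (length cs) +ℙ change a (lastV a cs)
      ≡⟨ cong₂ (λ n z → parity n +ℙ change a z) length-cs (lastV-colours-edgesFrom c a s r v₂) ⟩
    parity (suc (length r)) +ℙ change a (col c (lastV s r) v₂)
      ≡⟨ cong (_+ℙ change a (col c (lastV s r) v₂)) (parity-suc (length r)) ⟩
    parity (length r) ⁻¹ +ℙ change a (col c (lastV s r) v₂) ∎
    where
    a  = col c v₁ s
    cs = colours c (edgesFrom s (r ++ v₂ ∷ []))
    length-cs : length cs ≡ suc (length r)
    length-cs = trans (length-colours-edgesFrom c s (r ++ v₂ ∷ [])) (trans (length-++ r) (+-comm (length r) 1))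

lemma1 : (G : Graph) → let open Graph G in
    (C₁ C₂ : Walk G) → Closed {G} C₁ → Odd (len C₁) → Closed {G} C₂ → Odd (len C₂) →
    (v₁ u₁ u₂ v₂ : V) → Stubborn {G} (v₁ , u₁) → Stubborn {G} (u₂ , v₂) →
    (W₁ W₂ : Walk G) →
    WalkFromTo W₁ u₁ u₂ → SegmentOf W₁ C₁ →
    ¬ UsesEdge W₁ (v₁ , u₁) → ¬ UsesEdge W₁ (u₂ , v₂) →
    WalkFromTo W₂ u₁ u₂ → SegmentOf W₂ C₂ →
    ¬ UsesEdge W₂ (v₁ , u₁) → ¬ UsesEdge W₂ (u₂ , v₂) →
    (c : Colouring {G}) →
    sameInExtended c v₁ W₁ v₂ % 2 ≡ sameInExtended c v₁ W₂ v₂ % 2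
lemma1 G _ _ _ _ _ _ v₁ u₁ u₂ v₂ e₁-stubborn _ W₁ W₂ (s₁ , t₁) _ avoid₁ _ (s₂ , t₂) _ avoid₂ _ c =
  parity⇒%2 (sameInExtended c v₁ W₁ v₂) (sameInExtended c v₁ W₂ v₂) (begin
    parity (sameInExtended c v₁ W₁ v₂)
      ≡⟨ parity-sameInExtended c v₁ W₁ v₂ ⟩
    parity (len W₁) ⁻¹ +ℙ change (col c v₁ (start W₁)) (col c (endV W₁) v₂)
      ≡⟨ cong₂ _+ℙ_ (cong _⁻¹ (stubborn-len-parity W₁ W₂ e₁-stubborn (s₁ , t₁) (s₂ , t₂) avoid₁ avoid₂))
                    (cong₂ (λ x y → change (col c v₁ x) (col c y v₂)) (trans s₁ (sym s₂)) (trans t₁ (sym t₂))) ⟩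
    parity (len W₂) ⁻¹ +ℙ change (col c v₁ (start W₂)) (col c (endV W₂) v₂)
      ≡⟨ sym (parity-sameInExtended c v₁ W₂ v₂) ⟩
    parity (sameInExtended c v₁ W₂ v₂) ∎)
  where open Walk using (start)
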